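{- There exist binary words $x,y$ such that $J_{\mathrm{rect}}(xy)<J_{\mathrm{rect}}(x)$. (That is, the statement "for all binary words $x,y$, $J_{\mathrm{rect}}(x)\le J_{\mathrm{rect}}(xy)$" is false.)
   Context: Words are finite strings over $\{0,1\}$ ($0$ = hydrophobic, $1$ = polar); $xy$ denotes concatenation. A fold of a word $w=w_1\cdots w_n$ in the 2D rectangular lattice $\mathbb Z^2$ is a self-avoiding walk $v_1,\dots,v_n$ in $\mathbb Z^2$ (distinct vertices, $v_i$ adjacent to $v_{i+1}$). The score of the fold is the number of pairs $\{i,j\}$ with $|i-j|\ge 2$, $w_i=w_j=0$ and $v_i,v_j$ adjacent in $\mathbb Z^2$. $J_{\mathrm{rect}}(w)$ is the maximum score over all folds of $w$. -}

module Defs where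

open import Data.Bool using (Bool; true; false; _∧_; if_then_else_)
open import Data.Nat using (ℕ; zero; suc; _+_; _≤_; _≤ᵇ_; _≡ᵇ_)
open import Data.Integer using (ℤ; ∣_∣; _-_)
open import Data.Product using (_×_; _,_; proj₁; proj₂)
open import Data.Fin using (Fin; toℕ)
open import Data.List using (List; length; lookup; allFin; map; concatMap)
open import Data.Nat.ListAction using (sum)
open import Relation.Binary.PropositionalEquality using (_≡_)
open import Function.Definitions using (Injective)

-- Letters: b0 = hydrophobic (0), b1 = polar (1)
data Bit : Set where
  b0 b1 : Bit

Word : Set
Word = List Bit

isZero : Bit → Bool
isZero b0 = true
isZero b1 = false

Pt : Set
Pt = ℤ × ℤ

dist : Pt → Pt → ℕ
dist (a , b) (c , d) = ∣ a - c ∣ + ∣ b - d ∣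

Adjacent : Pt → Pt → Set
Adjacent p q = dist p q ≡ 1

Placement : Word → Set
Placement w = Fin (length w) → Pt

IsFold : (w : Word) → Placement w → Set
IsFold w v =
  Injective _≡_ _≡_ v ×
  (∀ (i j : Fin (length w)) → toℕ j ≡ suc (toℕ i) → Adjacent (v i) (v j))

contact : (w : Word) → Placement w → Fin (length w) → Fin (length w) → Bool
contact w v i j =
  isZero (lookup w i) ∧ isZero (lookup w j) ∧
  (suc (suc (toℕ i)) ≤ᵇ toℕ j) ∧ (dist (v i) (v j) ≡ᵇ 1)

score : (w : Word) → Placement w → ℕ
score w v =
  sum (concatMap (λ i → map (λ j → if contact w v i j then 1 else 0)
                             (allFin (length w)))
                 (allFin (length w)))

IsJrect : Word → ℕ → Set
IsJrect w k =
  (Data.Product.Σ (Placement w) λ v → IsFold w v × score w v ≡ k) ×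
  (∀ (v : Placement w) → IsFold w v → score w v ≤ k)

{-# OPTIONS --safe #-}
-- Colour ℤ² as a checkerboard. Consecutive vertices of a fold have opposite
-- colours, so in x₀ = 01010100 the hydrophobic positions 0, 2, 4, 6 all get the
-- same colour and never touch: the only possible contacts are between position 7
-- and positions 0, 2, 4, whence J(x₀) ≤ 3, and folding x₀ around position 7
-- attains 3. In x₀y₀ = 010101001 position 7 also has the chain neighbours 6 and
-- 8, and a lattice point has only four neighbours, so at most two of 0, 2, 4 can
-- touch it and J(x₀y₀) ≤ 2.
module Submission where

open import Defs
open import Data.Nat using (ℕ; _<_)
open import Data.List using (_++_)
open import Data.Product using (Σ; _×_)

open import Data.Bool using (true; false; T; if_then_else_)
open import Data.Fin as Fin using (Fin; toℕ)
open import Data.Fin.Patterns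
open import Data.Fin.Properties using (injective⇒≤) renaming (_≟_ to _≟ᶠ_)
open import Data.Integer as ℤ using (ℤ; +_; -[1+_]; ∣_∣; _-_; 1ℤ; -1ℤ)
open import Data.Integer.Properties
  using (∣i∣≡0⇒i≡0; i-j≡0⇒i≡j; ∣i-j∣≡∣j-i∣; ∣-i∣≡∣i∣; 1-[1+n]≡-n; suc-pred)
  renaming (+-comm to +ℤ-comm)
open import Data.Integer.Tactic.RingSolver using (solve-∀)
open import Data.List as List using (List; []; _∷_; length)
open import Data.Nat as ℕ using (zero; suc; _+_; _≤_; z≤n; _≡ᵇ_; parity)
open import Data.Nat.ListAction using (sum)
open import Data.Nat.Properties
  using (≤-refl; +-mono-≤; +-identityʳ; suc-injective; ≡ᵇ⇒≡; n<1+n; n≮n; module ≤-Reasoning)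
open import Data.Parity as ℙ using (Parity; 0ℙ; 1ℙ; _⁻¹)
open import Data.Parity.Properties using (⁻¹-selfInverse; ⁻¹-involutive; suc-homo-⁻¹; p≢p⁻¹)
open import Data.Product using (∃-syntax; _,_; proj₁; proj₂)
open import Data.Product.Properties using (≡-dec)
open import Data.Sum using (_⊎_; inj₁; inj₂)
open import Data.Unit using (tt)
open import Data.Vec using (Vec; []; _∷_; lookup)
open import Data.Vec.Relation.Unary.AllPairs using (allPairs?)
open import Data.Vec.Relation.Unary.Linked using (Linked; [-]; _∷_; linked?)
open import Data.Vec.Relation.Unary.Unique.Propositional using (Unique)
open import Data.Vec.Relation.Unary.Unique.Propositional.Properties using (lookup-injective)
open import Function using (_∘_)
open import Function.Definitions using (Injective)
open import Relation.Binary.Core using (Rel)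
open import Relation.Binary.Definitions using (DecidableEquality; Decidable)
open import Relation.Binary.PropositionalEquality
open import Relation.Nullary using (¬_; Dec; yes; no; ¬?; contradiction)
open import Relation.Nullary.Decidable using (from-yes)

m+n≡1⇒m≡1∧n≡0∨m≡0∧n≡1 : ∀ m n → m + n ≡ 1 → (m ≡ 1 × n ≡ 0) ⊎ (m ≡ 0 × n ≡ 1)
m+n≡1⇒m≡1∧n≡0∨m≡0∧n≡1 zero       n    eq   = inj₂ (refl , eq)
m+n≡1⇒m≡1∧n≡0∨m≡0∧n≡1 (suc zero) zero refl = inj₁ (refl , refl)

∣i∣≡1⇒i≡±1 : ∀ i → ∣ i ∣ ≡ 1 → i ≡ 1ℤ ⊎ i ≡ -1ℤ
∣i∣≡1⇒i≡±1 (+ .1)      refl = inj₁ refl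
∣i∣≡1⇒i≡±1 -[1+ zero ] refl = inj₂ refl

∣i-j∣≡0⇒i≡j : ∀ i j → ∣ i - j ∣ ≡ 0 → i ≡ j
∣i-j∣≡0⇒i≡j i j = i-j≡0⇒i≡j i j ∘ ∣i∣≡0⇒i≡0

i-j≡k⇒j≡i-k : ∀ i j k → i - j ≡ k → j ≡ i - k
i-j≡k⇒j≡i-k i j k refl = sym (i-[i-j]≡j i j)
  where
  i-[i-j]≡j : ∀ i j → i - (i - j) ≡ j
  i-[i-j]≡j = solve-∀

∣i-j∣≡1⇒j≡i±1 : ∀ i j → ∣ i - j ∣ ≡ 1 → j ≡ ℤ.suc i ⊎ j ≡ ℤ.pred i
∣i-j∣≡1⇒j≡i±1 i j h with ∣i∣≡1⇒i≡±1 (i - j) h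
... | inj₁ i-j≡1  = inj₂ (trans (i-j≡k⇒j≡i-k i j 1ℤ i-j≡1) (+ℤ-comm i -1ℤ))
... | inj₂ i-j≡-1 = inj₁ (trans (i-j≡k⇒j≡i-k i j -1ℤ i-j≡-1) (+ℤ-comm i 1ℤ))

a+[b+c]≤2 : ∀ {a b c} → a ≤ 1 → b ≤ 1 → c ≤ 1 → a ≡ 0 ⊎ b ≡ 0 ⊎ c ≡ 0 → a + (b + c) ≤ 2
a+[b+c]≤2 a≤1 b≤1 c≤1 (inj₁ refl)        = +-mono-≤ b≤1 c≤1
a+[b+c]≤2 a≤1 b≤1 c≤1 (inj₂ (inj₁ refl)) = +-mono-≤ a≤1 c≤1
a+[b+c]≤2 a≤1 b≤1 c≤1 (inj₂ (inj₂ refl)) = +-mono-≤ a≤1 (+-mono-≤ b≤1 z≤n)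

unique? : ∀ {a} {A : Set a} {n} → DecidableEquality A → (xs : Vec A n) → Dec (Unique xs)
unique? _≟_ = allPairs? (λ x y → ¬? (x ≟ y))

lookup-linked : ∀ {a ℓ} {A : Set a} {R : Rel A ℓ} {n} {xs : Vec A n} → Linked R xs →
                ∀ i j → toℕ j ≡ suc (toℕ i) → R (lookup xs i) (lookup xs j)
lookup-linked {xs = _ ∷ _ ∷ _} (r ∷ _) 0F 1F refl = r
lookup-linked (_ ∷ rs) (Fin.suc i) (Fin.suc j) eq = lookup-linked rs i j (suc-injective eq)
lookup-linked [-] 0F (Fin.suc ()) _

lookup-isFold : ∀ w {ps : Vec Pt (length w)} →
                Unique ps → Linked Adjacent ps → IsFold w (lookup ps)
lookup-isFold w unique linked = (λ {i} {j} → lookup-injective unique i j) , lookup-linked linked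

parity-suc : ∀ n → parity (suc n) ≡ parity n ⁻¹
parity-suc n = sym (⁻¹-selfInverse (suc-homo-⁻¹ n))

parityℤ : ℤ → Parity
parityℤ i = parity ∣ i ∣

parityℤ-suc : ∀ i → parityℤ (ℤ.suc i) ≡ parityℤ i ⁻¹
parityℤ-suc (+ n) = parity-suc n
parityℤ-suc -[1+ n ] = begin
  parity ∣ ℤ.suc -[1+ n ] ∣  ≡⟨ cong (parity ∘ ∣_∣) (1-[1+n]≡-n n) ⟩
  parity ∣ ℤ.- (+ n) ∣       ≡⟨ cong parity (∣-i∣≡∣i∣ (+ n)) ⟩
  parity n                   ≡⟨ suc-homo-⁻¹ n ⟨
  parity (suc n) ⁻¹          ∎
  where open ≡-Reasoning

parityℤ-pred : ∀ i → parityℤ (ℤ.pred i) ≡ parityℤ i ⁻¹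
parityℤ-pred i = sym (⁻¹-selfInverse (begin
  parityℤ (ℤ.pred i) ⁻¹       ≡⟨ parityℤ-suc (ℤ.pred i) ⟨
  parityℤ (ℤ.suc (ℤ.pred i))  ≡⟨ cong parityℤ (suc-pred i) ⟩
  parityℤ i                   ∎))
  where open ≡-Reasoning

p⁻¹+q≡[p+q]⁻¹ : ∀ p q → p ⁻¹ ℙ.+ q ≡ (p ℙ.+ q) ⁻¹
p⁻¹+q≡[p+q]⁻¹ 0ℙ q = refl
p⁻¹+q≡[p+q]⁻¹ 1ℙ q = sym (⁻¹-involutive q)

p+q⁻¹≡[p+q]⁻¹ : ∀ p q → p ℙ.+ q ⁻¹ ≡ (p ℙ.+ q) ⁻¹
p+q⁻¹≡[p+q]⁻¹ 0ℙ q = refl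
p+q⁻¹≡[p+q]⁻¹ 1ℙ q = refl

colour : Pt → Parity
colour (a , b) = parityℤ a ℙ.+ parityℤ b

neighbour : Pt → Fin 4 → Pt
neighbour (a , b) 0F = (ℤ.suc a , b)
neighbour (a , b) 1F = (ℤ.pred a , b)
neighbour (a , b) 2F = (a , ℤ.suc b)
neighbour (a , b) 3F = (a , ℤ.pred b)

colour-neighbour : ∀ p d → colour (neighbour p d) ≡ colour p ⁻¹
colour-neighbour (a , b) 0F =
  trans (cong (ℙ._+ parityℤ b) (parityℤ-suc a)) (p⁻¹+q≡[p+q]⁻¹ (parityℤ a) (parityℤ b))
colour-neighbour (a , b) 1F =
  trans (cong (ℙ._+ parityℤ b) (parityℤ-pred a)) (p⁻¹+q≡[p+q]⁻¹ (parityℤ a) (parityℤ b))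
colour-neighbour (a , b) 2F =
  trans (cong (parityℤ a ℙ.+_) (parityℤ-suc b)) (p+q⁻¹≡[p+q]⁻¹ (parityℤ a) (parityℤ b))
colour-neighbour (a , b) 3F =
  trans (cong (parityℤ a ℙ.+_) (parityℤ-pred b)) (p+q⁻¹≡[p+q]⁻¹ (parityℤ a) (parityℤ b))

adjacent⇒neighbour : ∀ {p q} → Adjacent p q → ∃[ d ] q ≡ neighbour p d
adjacent⇒neighbour {a , b} {a′ , b′} adj with m+n≡1⇒m≡1∧n≡0∨m≡0∧n≡1 ∣ a - a′ ∣ ∣ b - b′ ∣ adj
... | inj₁ (h₁ , h₀) with ∣i-j∣≡1⇒j≡i±1 a a′ h₁ | ∣i-j∣≡0⇒i≡j b b′ h₀
...   | inj₁ refl | refl = 0F , refl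
...   | inj₂ refl | refl = 1F , refl
adjacent⇒neighbour {a , b} {a′ , b′} adj | inj₂ (h₀ , h₁)
  with ∣i-j∣≡0⇒i≡j a a′ h₀ | ∣i-j∣≡1⇒j≡i±1 b b′ h₁
...   | refl | inj₁ refl = 2F , refl
...   | refl | inj₂ refl = 3F , refl

adjacent-sym : ∀ {p q} → Adjacent p q → Adjacent q p
adjacent-sym {a , b} {a′ , b′} = trans (cong₂ _+_ (∣i-j∣≡∣j-i∣ a′ a) (∣i-j∣≡∣j-i∣ b′ b))

colour-adjacent : ∀ {p q} → Adjacent p q → colour q ≡ colour p ⁻¹
colour-adjacent {p} {q} adj with adjacent⇒neighbour {p} {q} adj
... | d , refl = colour-neighbour p d

equal-colour⇒¬adjacent : ∀ {p q} → colour p ≡ colour q → ¬ Adjacent p q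
equal-colour⇒¬adjacent {p} {q} eq adj =
  p≢p⁻¹ (colour p) (trans eq (colour-adjacent {p} {q} adj))

neighbours≤4 : ∀ {n} {f : Fin n → Pt} {q} →
               Injective _≡_ _≡_ f → (∀ k → Adjacent (f k) q) → n ≤ 4
neighbours≤4 {f = f} {q} f-injective adj = injective⇒≤ direction-injective
  where
  direction : ∀ k → ∃[ d ] f k ≡ neighbour q d
  direction k = adjacent⇒neighbour {q} {f k} (adjacent-sym {f k} {q} (adj k))

  direction-injective : Injective _≡_ _≡_ (proj₁ ∘ direction)
  direction-injective {i} {j} eq = f-injective (begin
    f i                                ≡⟨ proj₂ (direction i) ⟩
    neighbour q (proj₁ (direction i))  ≡⟨ cong (neighbour q) eq ⟩
    neighbour q (proj₁ (direction j))  ≡⟨ proj₂ (direction j) ⟨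
    f j                                ∎)
    where open ≡-Reasoning

IsWalk : ∀ {n} → (Fin n → Pt) → Set
IsWalk v = ∀ i j → toℕ j ≡ suc (toℕ i) → Adjacent (v i) (v j)

walk-colour-two-steps : ∀ {n} (v : Fin n → Pt) → IsWalk v → ∀ i j k →
                        toℕ j ≡ suc (toℕ i) → toℕ k ≡ suc (toℕ j) → colour (v k) ≡ colour (v i)
walk-colour-two-steps v walk i j k j≡1+i k≡1+j = begin
  colour (v k)        ≡⟨ colour-adjacent {v j} {v k} (walk j k k≡1+j) ⟩
  colour (v j) ⁻¹     ≡⟨ cong _⁻¹ (colour-adjacent {v i} {v j} (walk i j j≡1+i)) ⟩
  colour (v i) ⁻¹ ⁻¹  ≡⟨ ⁻¹-involutive (colour (v i)) ⟩
  colour (v i)        ∎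
  where open ≡-Reasoning

adjacency : Pt → Pt → ℕ
adjacency p q = if dist p q ≡ᵇ 1 then 1 else 0

adjacent? : Decidable Adjacent
adjacent? p q = dist p q ℕ.≟ 1

adjacency≤1 : ∀ p q → adjacency p q ≤ 1
adjacency≤1 p q with dist p q ≡ᵇ 1
... | true  = ≤-refl
... | false = z≤n

¬adjacent⇒adjacency≡0 : ∀ p q → ¬ Adjacent p q → adjacency p q ≡ 0
¬adjacent⇒adjacency≡0 p q ¬adj with dist p q ≡ᵇ 1 in eq
... | true  = contradiction (≡ᵇ⇒≡ (dist p q) 1 (subst T (sym eq) tt)) ¬adj
... | false = refl

adjacency-three≤2 : ∀ p q r s → ¬ (Adjacent p s × Adjacent q s × Adjacent r s) →
                    adjacency p s + (adjacency q s + adjacency r s) ≤ 2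
adjacency-three≤2 p q r s ¬all =
  a+[b+c]≤2 (adjacency≤1 p s) (adjacency≤1 q s) (adjacency≤1 r s) some-adjacency≡0
  where
  some-adjacency≡0 : adjacency p s ≡ 0 ⊎ adjacency q s ≡ 0 ⊎ adjacency r s ≡ 0
  some-adjacency≡0 with adjacent? p s | adjacent? q s | adjacent? r s
  ... | no ¬a | _     | _     = inj₁ (¬adjacent⇒adjacency≡0 p s ¬a)
  ... | yes _ | no ¬b | _     = inj₂ (inj₁ (¬adjacent⇒adjacency≡0 q s ¬b))
  ... | yes _ | yes _ | no ¬c = inj₂ (inj₂ (¬adjacent⇒adjacency≡0 r s ¬c))
  ... | yes a | yes b | yes c = contradiction (a , b , c) ¬all

x₀ : Word
x₀ = b0 ∷ b1 ∷ b0 ∷ b1 ∷ b0 ∷ b1 ∷ b0 ∷ b0 ∷ []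

y₀ : Word
y₀ = b1 ∷ []

hydrophobicPairs : ∀ {m} → List (Fin (8 + m) × Fin (8 + m))
hydrophobicPairs = (0F , 2F) ∷ (0F , 4F) ∷ (0F , 6F) ∷ (0F , 7F) ∷ (2F , 4F) ∷
                   (2F , 6F) ∷ (2F , 7F) ∷ (4F , 6F) ∷ (4F , 7F) ∷ []

contacts : ∀ {m} → (Fin (8 + m) → Pt) → ℕ
contacts v = sum (List.map (λ (i , j) → adjacency (v i) (v j)) hydrophobicPairs)

-- Definitional: contact is false on every pair outside hydrophobicPairs.
score-x₀ : ∀ v → score x₀ v ≡ contacts v
score-x₀ v = refl

score-x₀y₀ : ∀ v → score (x₀ ++ y₀) v ≡ contacts v
score-x₀y₀ v = refl

module _ {m} (v : Fin (8 + m) → Pt) (walk : IsWalk v) where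
  private
    c₂ : colour (v 2F) ≡ colour (v 0F)
    c₂ = walk-colour-two-steps v walk 0F 1F 2F refl refl
    c₄ : colour (v 4F) ≡ colour (v 0F)
    c₄ = trans (walk-colour-two-steps v walk 2F 3F 4F refl refl) c₂
    c₆ : colour (v 6F) ≡ colour (v 0F)
    c₆ = trans (walk-colour-two-steps v walk 4F 5F 6F refl refl) c₄

    vanish : ∀ i j → colour (v i) ≡ colour (v 0F) → colour (v j) ≡ colour (v 0F) →
             adjacency (v i) (v j) ≡ 0
    vanish i j cᵢ cⱼ = ¬adjacent⇒adjacency≡0 (v i) (v j)
                         (equal-colour⇒¬adjacent {v i} {v j} (trans cᵢ (sym cⱼ)))

  walk⇒contacts≡adjacencies-to-7 :
    contacts v ≡ adjacency (v 0F) (v 7F) + (adjacency (v 2F) (v 7F) + adjacency (v 4F) (v 7F))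
  walk⇒contacts≡adjacencies-to-7
    rewrite vanish 0F 2F refl c₂ | vanish 0F 4F refl c₄ | vanish 0F 6F refl c₆
          | vanish 2F 4F c₂ c₄   | vanish 2F 6F c₂ c₆   | vanish 4F 6F c₄ c₆
          | +-identityʳ (adjacency (v 4F) (v 7F)) = refl

score-x₀≤3 : ∀ v → IsFold x₀ v → score x₀ v ≤ 3
score-x₀≤3 v (_ , walk) = begin
  score x₀ v     ≡⟨ score-x₀ v ⟩
  contacts v     ≡⟨ walk⇒contacts≡adjacencies-to-7 v walk ⟩
  adjacency (v 0F) (v 7F) + (adjacency (v 2F) (v 7F) + adjacency (v 4F) (v 7F))
                 ≤⟨ +-mono-≤ (adjacency≤1 (v 0F) (v 7F))
                      (+-mono-≤ (adjacency≤1 (v 2F) (v 7F)) (adjacency≤1 (v 4F) (v 7F))) ⟩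
  3              ∎
  where open ≤-Reasoning

injective-walk⇒¬all-adjacent-to-7 : ∀ {m} (v : Fin (9 + m) → Pt) → Injective _≡_ _≡_ v → IsWalk v →
                ¬ (Adjacent (v 0F) (v 7F) × Adjacent (v 2F) (v 7F) × Adjacent (v 4F) (v 7F))
injective-walk⇒¬all-adjacent-to-7 v v-injective walk (a₀ , a₂ , a₄) =
  n≮n 4 (neighbours≤4 {f = v ∘ lookup evenPositions} {v 7F} positions-injective adjacent-to-7)
  where
  evenPositions : Vec (Fin _) 5
  evenPositions = 0F ∷ 2F ∷ 4F ∷ 6F ∷ 8F ∷ []

  positions-injective : Injective _≡_ _≡_ (v ∘ lookup evenPositions)
  positions-injective {i} {j} =
    lookup-injective (from-yes (unique? _≟ᶠ_ evenPositions)) i j ∘ v-injective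

  adjacent-to-7 : ∀ k → Adjacent (v (lookup evenPositions k)) (v 7F)
  adjacent-to-7 0F = a₀
  adjacent-to-7 1F = a₂
  adjacent-to-7 2F = a₄
  adjacent-to-7 3F = walk 6F 7F refl
  adjacent-to-7 4F = adjacent-sym {v 7F} {v 8F} (walk 7F 8F refl)

score-x₀y₀≤2 : ∀ v → IsFold (x₀ ++ y₀) v → score (x₀ ++ y₀) v ≤ 2
score-x₀y₀≤2 v (v-injective , walk) = begin
  score (x₀ ++ y₀) v  ≡⟨ score-x₀y₀ v ⟩
  contacts v          ≡⟨ walk⇒contacts≡adjacencies-to-7 v walk ⟩
  adjacency (v 0F) (v 7F) + (adjacency (v 2F) (v 7F) + adjacency (v 4F) (v 7F))
                      ≤⟨ adjacency-three≤2 (v 0F) (v 2F) (v 4F) (v 7F) (injective-walk⇒¬all-adjacent-to-7 v v-injective walk) ⟩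
  2                   ∎
  where open ≤-Reasoning

_≟ᵖ_ : DecidableEquality Pt
_≟ᵖ_ = ≡-dec ℤ._≟_ ℤ._≟_

x₀-fold : Vec Pt 8
x₀-fold = (+ 0 , + 0) ∷ (+ 1 , + 0) ∷ (+ 1 , + 1) ∷ (+ 1 , + 2) ∷
          (+ 0 , + 2) ∷ (-1ℤ , + 2) ∷ (-1ℤ , + 1) ∷ (+ 0 , + 1) ∷ []

x₀y₀-fold : Vec Pt 9
x₀y₀-fold = (+ 0 , + 0) ∷ (+ 1 , + 0) ∷ (+ 2 , + 0) ∷ (+ 3 , + 0) ∷ (+ 3 , + 1) ∷
            (+ 3 , + 2) ∷ (+ 2 , + 2) ∷ (+ 2 , + 1) ∷ (+ 1 , + 1) ∷ []

Jrect-x₀ : IsJrect x₀ 3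
Jrect-x₀ = (lookup x₀-fold , fold , refl) , score-x₀≤3
  where
  fold : IsFold x₀ (lookup x₀-fold)
  fold = lookup-isFold x₀ (from-yes (unique? _≟ᵖ_ x₀-fold))
                          (from-yes (linked? adjacent? x₀-fold))

Jrect-x₀y₀ : IsJrect (x₀ ++ y₀) 2
Jrect-x₀y₀ = (lookup x₀y₀-fold , fold , refl) , score-x₀y₀≤2
  where
  fold : IsFold (x₀ ++ y₀) (lookup x₀y₀-fold)
  fold = lookup-isFold (x₀ ++ y₀) (from-yes (unique? _≟ᵖ_ x₀y₀-fold))
                                  (from-yes (linked? adjacent? x₀y₀-fold))

corollary2p6 : Σ Word λ x → Σ Word λ y → Σ ℕ λ jx → Σ ℕ λ jxy →
    IsJrect x jx × IsJrect (x ++ y) jxy × jxy < jx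
corollary2p6 = x₀ , y₀ , 3 , 2 , Jrect-x₀ , Jrect-x₀y₀ , n<1+n 2
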